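{- Let $X,Y$ be symmetric apartness spaces and let $X\Cup Y=(X\times\{0\})\cup(Y\times\{1\})$. For $A\subset X\Cup Y$ write $A^0=\{x\in X:(x,0)\in A\}$ and $A^1=\{y\in Y:(y,1)\in A\}$. Then the relation defined for subsets $A,B$ of $X\Cup Y$ by $A\bowtie_{X\Cup Y}B\Leftrightarrow(A^0\bowtie_X B^0\wedge A^1\bowtie_Y B^1)$ is a symmetric apartness on $X\Cup Y$.
   Context: Work in Bishop-style constructive mathematics (intuitionistic logic). For an inhabited set $Z$ with inequality $\neq$ and a relation $\bowtie$ between subsets, write $x\bowtie S$ for $\{x\}\bowtie S$, ${\sim}S=\{z:\forall_{s\in S}(z\neq s)\}$ and $-S=\{z: z\bowtie S\}$. $\bowtie$ is an apartness on $Z$ if: (B1) $Z\bowtie\varnothing$; (B2) $-A\subset{\sim}A$; (B3) $(A_1\cup A_2)\bowtie(B_1\cup B_2)$ iff $A_i\bowtie B_j$ for all $i,j\in\{1,2\}$; (B4) $-A\subset{\sim}B\Rightarrow-A\subset-B$; (B5) $z\in-A\Rightarrow\exists_{S\subset Z}(z\in-S\wedge Z=-A\cup S)$. It is symmetric if $A\bowtie B\Rightarrow B\bowtie A$. Equality and inequality on $X\Cup Y$ are those induced from the components: $(a,i)=(b,j)$ iff $i=j$ and $a=b$ in the corresponding space, and $(a,i)\neq(b,j)$ iff $i\neq j$, or $i=j$ and $a\neq b$ in the corresponding space. -}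

module Defs where

open import Data.Empty using (⊥)
open import Data.Unit using (⊤)
open import Data.Product using (Σ; ∃; _×_; _,_)
open import Data.Sum using (_⊎_; inj₁; inj₂)
open import Relation.Nullary using (¬_)
open import Relation.Binary using (IsEquivalence)

Subset : Set → Set₁
Subset Z = Z → Set

module SetOps {Z : Set} (_≈_ : Z → Z → Set) (_≠_ : Z → Z → Set) where

  ∅ : Subset Z
  ∅ _ = ⊥

  whole : Subset Z
  whole _ = ⊤

  ⟨_⟩ : Z → Subset Z
  ⟨ x ⟩ y = y ≈ x

  _∪_ : Subset Z → Subset Z → Subset Z
  (A ∪ B) z = A z ⊎ B z

  _⊆_ : Subset Z → Subset Z → Set
  A ⊆ B = ∀ z → A z → B z

  _≐_ : Subset Z → Subset Z → Set
  A ≐ B = (A ⊆ B) × (B ⊆ A)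

  ∼_ : Subset Z → Subset Z
  (∼ S) z = ∀ s → S s → z ≠ s

  module Bowtie (_⋈_ : Subset Z → Subset Z → Set) where

    -_ : Subset Z → Subset Z
    (- S) z = ⟨ z ⟩ ⋈ S

-- The field 'resp' expresses that ⋈ is a
-- relation on the (extensional) power set, i.e. respects equality of subsets.
record IsApartness {Z : Set} (_≈_ _≠_ : Z → Z → Set)
                   (_⋈_ : Subset Z → Subset Z → Set) : Set₁ where
  open SetOps _≈_ _≠_
  open Bowtie _⋈_
  field
    resp : ∀ {A A′ B B′} → A ≐ A′ → B ≐ B′ → A ⋈ B → A′ ⋈ B′
    B1 : whole ⋈ ∅
    B2 : ∀ A → (- A) ⊆ (∼ A)
    B3 : ∀ A₁ A₂ B₁ B₂ →
         (((A₁ ∪ A₂) ⋈ (B₁ ∪ B₂)) →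
           (A₁ ⋈ B₁) × (A₁ ⋈ B₂) × (A₂ ⋈ B₁) × (A₂ ⋈ B₂))
         × ((A₁ ⋈ B₁) × (A₁ ⋈ B₂) × (A₂ ⋈ B₁) × (A₂ ⋈ B₂) →
           ((A₁ ∪ A₂) ⋈ (B₁ ∪ B₂)))
    B4 : ∀ A B → (- A) ⊆ (∼ B) → (- A) ⊆ (- B)
    B5 : ∀ A z → (- A) z →
         Σ (Subset Z) λ S → (- S) z × (whole ≐ ((- A) ∪ S))

IsSymmetric : {Z : Set} → (Subset Z → Subset Z → Set) → Set₁
IsSymmetric {Z} _⋈_ = ∀ (A B : Subset Z) → A ⋈ B → B ⋈ A

record ApartnessSpace : Set₁ where
  field
    Carrier : Set
    _≈_ : Carrier → Carrier → Set
    _≠_ : Carrier → Carrier → Set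
    isEquivalence : IsEquivalence _≈_
    ≠⇒≉ : ∀ {x y} → x ≠ y → ¬ (x ≈ y)
    ≠-sym : ∀ {x y} → x ≠ y → y ≠ x
    inhabitant : Carrier
    _⋈_ : Subset Carrier → Subset Carrier → Set
    isApartness : IsApartness _≈_ _≠_ _⋈_

-- The disjoint union X ⋓ Y = (X × {0}) ∪ (Y × {1}), with (x,0) ↦ inj₁ x,
-- (y,1) ↦ inj₂ y.
module Union (X Y : ApartnessSpace) where
  private
    module X = ApartnessSpace X
    module Y = ApartnessSpace Y

  Carrier : Set
  Carrier = X.Carrier ⊎ Y.Carrier

  _≈_ : Carrier → Carrier → Set
  inj₁ a ≈ inj₁ b = a X.≈ b
  inj₂ a ≈ inj₂ b = a Y.≈ b
  inj₁ _ ≈ inj₂ _ = ⊥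
  inj₂ _ ≈ inj₁ _ = ⊥

  _≠_ : Carrier → Carrier → Set
  inj₁ a ≠ inj₁ b = a X.≠ b
  inj₂ a ≠ inj₂ b = a Y.≠ b
  inj₁ _ ≠ inj₂ _ = ⊤
  inj₂ _ ≠ inj₁ _ = ⊤

  _⁰ : Subset Carrier → Subset X.Carrier
  (A ⁰) x = A (inj₁ x)

  _¹ : Subset Carrier → Subset Y.Carrier
  (A ¹) y = A (inj₂ y)

  _⋈_ : Subset Carrier → Subset Carrier → Set
  A ⋈ B = ((A ⁰) X.⋈ (B ⁰)) × ((A ¹) Y.⋈ (B ¹))

module Submission where

open import Data.Product using (Σ; _×_; _,_; proj₁; proj₂)
open import Data.Sum using (inj₁; inj₂)
import Data.Sum as Sum
open import Data.Unit using (⊤; tt)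
open import Defs

-- The apartness on X ⋓ Y is checked componentwise: a
-- subset A of the union is split into A⁰ ⊆ X and A¹ ⊆ Y, and each axiom
-- for the union follows from the same axiom in X and in Y.  The only
-- subtlety is that a point (x,0) is a singleton whose second component
-- is empty, so "(x,0) ⋈ A" needs, besides x ⋈ A⁰ in X, the fact
-- ∅ ⋈ A¹ in Y.  We therefore first prove two general facts about any
-- apartness: ⋈ is antitone in both arguments (from B3 and resp), and,
-- when ⋈ is symmetric, ∅ is apart from every set (from B1, symmetry and
-- antitonicity).  With these, "(x,0) ⋈ A" is equivalent to "x ⋈ A⁰"
-- (lemma lift⁰, and symmetrically lift¹), which turns B4 and B5 for the
-- union into B4 and B5 for the components.

module ApartnessFacts {Z : Set} {_≈_ _≠_ : Z → Z → Set}
                      {_⋈_ : Subset Z → Subset Z → Set}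
                      (apartness : IsApartness _≈_ _≠_ _⋈_) where
  open IsApartness apartness
  open SetOps _≈_ _≠_

  -- Shrinking either side preserves apartness: write A as A′ ∪ A and B
  -- as B′ ∪ B, and take one of the four conclusions of B3.
  ⋈-antitone : ∀ {A A′ B B′} → A′ ⊆ A → B′ ⊆ B → A ⋈ B → A′ ⋈ B′
  ⋈-antitone {A} {A′} {B} {B′} A′⊆A B′⊆B A⋈B =
    proj₁ (proj₁ (B3 A′ A B′ B) (resp (absorb A′⊆A) (absorb B′⊆B) A⋈B))
    where
    absorb : ∀ {C C′} → C′ ⊆ C → C ≐ (C′ ∪ C)
    absorb C′⊆C = (λ _ c → inj₂ c)
                , (λ { z (inj₁ c′) → C′⊆C z c′ ; _ (inj₂ c) → c })

  ∅-⋈ : IsSymmetric _⋈_ → ∀ B → ∅ ⋈ B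
  ∅-⋈ symmetric B = ⋈-antitone (λ _ ()) (λ _ _ → tt) (symmetric whole ∅ B1)

module UnionApartness (X Y : ApartnessSpace)
                      (symX : IsSymmetric (ApartnessSpace._⋈_ X))
                      (symY : IsSymmetric (ApartnessSpace._⋈_ Y)) where
  module X = ApartnessSpace X
  module Y = ApartnessSpace Y
  module AX = IsApartness X.isApartness
  module AY = IsApartness Y.isApartness
  module SX = SetOps X._≈_ X._≠_
  module SY = SetOps Y._≈_ Y._≠_
  module BX = SX.Bowtie X._⋈_
  module BY = SY.Bowtie Y._⋈_
  open Union X Y
  open SetOps _≈_ _≠_
  open Bowtie _⋈_

  ≐⁰ : ∀ {A A′} → A ≐ A′ → (A ⁰) SX.≐ (A′ ⁰)
  ≐⁰ (A⊆A′ , A′⊆A) = (λ x → A⊆A′ (inj₁ x)) , (λ x → A′⊆A (inj₁ x))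

  ≐¹ : ∀ {A A′} → A ≐ A′ → (A ¹) SY.≐ (A′ ¹)
  ≐¹ (A⊆A′ , A′⊆A) = (λ y → A⊆A′ (inj₂ y)) , (λ y → A′⊆A (inj₂ y))

  -- (x,0) ⋈ A follows from x ⋈ A⁰, because the second component of the
  -- singleton {(x,0)} is empty; the converse is the first projection.
  lift⁰ : ∀ {A x} → (BX.- (A ⁰)) x → (- A) (inj₁ x)
  lift⁰ {A} x⋈A⁰ = x⋈A⁰ , ApartnessFacts.∅-⋈ Y.isApartness symY (A ¹)

  lift¹ : ∀ {A y} → (BY.- (A ¹)) y → (- A) (inj₂ y)
  lift¹ {A} y⋈A¹ = ApartnessFacts.∅-⋈ X.isApartness symX (A ⁰) , y⋈A¹

  ∼⁰ : ∀ A B → (- A) ⊆ (∼ B) → (BX.- (A ⁰)) SX.⊆ (SX.∼ (B ⁰))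
  ∼⁰ A B h x x⋈A⁰ b = h (inj₁ x) (lift⁰ {A} x⋈A⁰) (inj₁ b)

  ∼¹ : ∀ A B → (- A) ⊆ (∼ B) → (BY.- (A ¹)) SY.⊆ (SY.∼ (B ¹))
  ∼¹ A B h y y⋈A¹ b = h (inj₂ y) (lift¹ {A} y⋈A¹) (inj₂ b)

  extend⁰ : Subset X.Carrier → Subset Carrier
  extend⁰ S₀ (inj₁ a) = S₀ a
  extend⁰ S₀ (inj₂ _) = ⊤

  extend¹ : Subset Y.Carrier → Subset Carrier
  extend¹ S₁ (inj₁ _) = ⊤
  extend¹ S₁ (inj₂ b) = S₁ b

  -- At a point of
  -- one component, take the witness S₀ given by B5 in that component and
  -- add the whole other component: the point stays apart from the new set,
  -- and the cover of the component lifts to the union by lift⁰ / lift¹.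
  B5-witness : Subset Carrier → Carrier → Set₁
  B5-witness A z = Σ (Subset Carrier) λ S → (- S) z × (whole ≐ ((- A) ∪ S))

  B5⁰ : ∀ A x → (- A) (inj₁ x) → B5-witness A (inj₁ x)
  B5⁰ A x (x⋈A⁰ , _) with AX.B5 (A ⁰) x x⋈A⁰
  ... | S₀ , x⋈S₀ , (covers , _) = extend⁰ S₀ , lift⁰ {extend⁰ S₀} x⋈S₀ , cover , (λ _ _ → tt)
    where
    cover : whole ⊆ ((- A) ∪ extend⁰ S₀)
    cover (inj₁ a) _ = Sum.map₁ (lift⁰ {A}) (covers a tt)
    cover (inj₂ _) _ = inj₂ tt

  B5¹ : ∀ A y → (- A) (inj₂ y) → B5-witness A (inj₂ y)
  B5¹ A y (_ , y⋈A¹) with AY.B5 (A ¹) y y⋈A¹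
  ... | S₁ , y⋈S₁ , (covers , _) = extend¹ S₁ , lift¹ {extend¹ S₁} y⋈S₁ , cover , (λ _ _ → tt)
    where
    cover : whole ⊆ ((- A) ∪ extend¹ S₁)
    cover (inj₁ _) _ = inj₂ tt
    cover (inj₂ b) _ = Sum.map₁ (lift¹ {A}) (covers b tt)

  isApartness : IsApartness _≈_ _≠_ _⋈_
  isApartness = record
    { resp = λ A≐A′ B≐B′ → λ { (p , q) →
        AX.resp (≐⁰ A≐A′) (≐⁰ B≐B′) p , AY.resp (≐¹ A≐A′) (≐¹ B≐B′) q }
    ; B1 = AX.B1 , AY.B1
    ; B2 = B2
    ; B3 = B3
    ; B4 = B4
    ; B5 = B5
    }
    where
    B2 : ∀ A → (- A) ⊆ (∼ A)
    B2 A (inj₁ x) (x⋈A⁰ , _) (inj₁ a) a∈A = AX.B2 (A ⁰) x x⋈A⁰ a a∈A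
    B2 A (inj₁ _) _          (inj₂ _) _   = tt
    B2 A (inj₂ _) _          (inj₁ _) _   = tt
    B2 A (inj₂ y) (_ , y⋈A¹) (inj₂ b) b∈A = AY.B2 (A ¹) y y⋈A¹ b b∈A

    B3 : ∀ A₁ A₂ B₁ B₂ →
         (((A₁ ∪ A₂) ⋈ (B₁ ∪ B₂)) →
           (A₁ ⋈ B₁) × (A₁ ⋈ B₂) × (A₂ ⋈ B₁) × (A₂ ⋈ B₂))
         × ((A₁ ⋈ B₁) × (A₁ ⋈ B₂) × (A₂ ⋈ B₁) × (A₂ ⋈ B₂) →
           ((A₁ ∪ A₂) ⋈ (B₁ ∪ B₂)))
    B3 A₁ A₂ B₁ B₂ = split , join
      where
      X₃ = AX.B3 (A₁ ⁰) (A₂ ⁰) (B₁ ⁰) (B₂ ⁰)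
      Y₃ = AY.B3 (A₁ ¹) (A₂ ¹) (B₁ ¹) (B₂ ¹)
      split : ((A₁ ∪ A₂) ⋈ (B₁ ∪ B₂)) →
              (A₁ ⋈ B₁) × (A₁ ⋈ B₂) × (A₂ ⋈ B₁) × (A₂ ⋈ B₂)
      split (p , q) with proj₁ X₃ p | proj₁ Y₃ q
      ... | p₁ , p₂ , p₃ , p₄ | q₁ , q₂ , q₃ , q₄ =
        (p₁ , q₁) , (p₂ , q₂) , (p₃ , q₃) , (p₄ , q₄)
      join : (A₁ ⋈ B₁) × (A₁ ⋈ B₂) × (A₂ ⋈ B₁) × (A₂ ⋈ B₂) →
             ((A₁ ∪ A₂) ⋈ (B₁ ∪ B₂))
      join ((p₁ , q₁) , (p₂ , q₂) , (p₃ , q₃) , (p₄ , q₄)) =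
        proj₂ X₃ (p₁ , p₂ , p₃ , p₄) , proj₂ Y₃ (q₁ , q₂ , q₃ , q₄)

    B4 : ∀ A B → (- A) ⊆ (∼ B) → (- A) ⊆ (- B)
    B4 A B h (inj₁ x) (x⋈A⁰ , _) = lift⁰ {B} (AX.B4 (A ⁰) (B ⁰) (∼⁰ A B h) x x⋈A⁰)
    B4 A B h (inj₂ y) (_ , y⋈A¹) = lift¹ {B} (AY.B4 (A ¹) (B ¹) (∼¹ A B h) y y⋈A¹)

    B5 : ∀ A z → (- A) z → B5-witness A z
    B5 A (inj₁ x) = B5⁰ A x
    B5 A (inj₂ y) = B5¹ A y

  isSymmetric : IsSymmetric _⋈_
  isSymmetric _ _ (p , q) = symX _ _ p , symY _ _ q

mainTheorem9 : (X Y : ApartnessSpace) →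
    IsSymmetric (ApartnessSpace._⋈_ X) →
    IsSymmetric (ApartnessSpace._⋈_ Y) →
    IsApartness (Union._≈_ X Y) (Union._≠_ X Y) (Union._⋈_ X Y)
      × IsSymmetric (Union._⋈_ X Y)
mainTheorem9 X Y symX symY =
  UnionApartness.isApartness X Y symX symY , UnionApartness.isSymmetric X Y symX symY
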